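{- Let $n \geq 6$ be even and suppose that $\frac{n}{\lfloor \log_2 n\rfloor + 1}$ is an integer. If $\gamma(KG_n) = \frac{n}{\lfloor \log_2 n\rfloor + 1}$, then $\frac{n}{\lfloor \log_2 n\rfloor + 1}$ is an even integer. Moreover, every minimum dominating set $D$ of $KG_n$ can be partitioned into two sets $D_E$ and $D_O$ of equal size, consisting of the even and the odd vertices of $D$, respectively.
   Context: For even $n \geq 6$, the Knödel graph $KG_n$ has vertex set $\{0,1,\dots,n-1\}$, and $\{x,y\}$ is an edge if and only if $x + y \equiv 2^t - 1 \pmod n$ for some $t \in \{1,2,\dots,\lfloor \log_2 n\rfloor\}$. A dominating set of a graph $G$ is a set $D$ of vertices such that every vertex is in $D$ or adjacent to a vertex of $D$; $\gamma(G)$ denotes the minimum size of a dominating set, and a dominating set of size $\gamma(G)$ is a minimum dominating set. -}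

module Defs where

open import Data.Nat using (ℕ; suc; _+_; _∸_; _^_; _≤_; _%_)
open import Data.Nat.Logarithm using (⌊log₂_⌋)
open import Data.Nat.Divisibility using (_∣_)
open import Data.Fin using (Fin; toℕ)
open import Data.Fin.Subset using (Subset; _∈_; _∩_; ∣_∣)
open import Data.Vec using (tabulate)
open import Data.Bool using (Bool; true; false; not)
open import Data.Nat using (_≡ᵇ_)
open import Data.Product using (∃; ∃-syntax; _×_)
open import Data.Sum using (_⊎_)
open import Relation.Binary.PropositionalEquality using (_≡_)

KGAdj : (n : ℕ) → Fin n → Fin n → Set
KGAdj n x y =
  ∃[ t ] (1 ≤ t × t ≤ ⌊log₂ n ⌋ ×
          ((toℕ x + toℕ y) % suc (n ∸ 1) ≡ (2 ^ t ∸ 1) % suc (n ∸ 1)))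
-- (modulus written as suc (n ∸ 1) to avoid a NonZero instance; equals n for n ≥ 1)

IsDominating : (n : ℕ) → Subset n → Set
IsDominating n D = ∀ v → v ∈ D ⊎ ∃[ u ] (u ∈ D × KGAdj n u v)

GammaKG≡ : ℕ → ℕ → Set
GammaKG≡ n k = (∃[ D ] (IsDominating n D × ∣ D ∣ ≡ k)) ×
               (∀ D → IsDominating n D → k ≤ ∣ D ∣)

IsMinDominating : (n : ℕ) → Subset n → Set
IsMinDominating n D = IsDominating n D × (∀ D' → IsDominating n D' → ∣ D ∣ ≤ ∣ D' ∣)

isEvenᵇ : ℕ → Bool
isEvenᵇ m = m % 2 ≡ᵇ 0

evens : (n : ℕ) → Subset n
evens n = tabulate (λ i → isEvenᵇ (toℕ i))

odds : (n : ℕ) → Subset n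
odds n = tabulate (λ i → not (isEvenᵇ (toℕ i)))

-- Since n is even and every 2^t - 1 is odd, every edge of KG_n joins an even and an odd
-- vertex, and every vertex has at most d = ⌊log₂ n⌋ neighbours. For a dominating set D
-- with e even and o odd vertices, the n/2 even vertices are covered by D itself and the
-- neighbours of its odd part, so n/2 ≤ e + o d, and symmetrically n/2 ≤ o + e d.
-- If |D| = n/(d+1) the two bounds add up to exactly n, so both are equalities, and
-- e + o d = o + e d forces e = o because d ≥ 2. In particular |D| = 2e.
module Submission where

open import Defs
open import Data.Nat using (ℕ; zero; suc; _+_; _*_; _∸_; _^_; _≤_; _/_; _%_; z≤n; s≤s)
open import Data.Nat.Properties
open import Data.Nat.DivMod
open import Data.Nat.Divisibility using (_∣_; divides)
open import Data.Nat.Logarithm using (⌊log₂_⌋; ⌊log₂⌋-mono-≤; ⌊log₂[2^n]⌋≡n)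
open import Data.Nat.Solver using (module +-*-Solver)
open import Data.Fin using (Fin; toℕ; fromℕ<) renaming (zero to fzero; suc to fsuc)
open import Data.Fin.Properties using (toℕ-injective; toℕ-fromℕ<; toℕ<n)
open import Data.Fin.Subset using (Subset; _∈_; _∩_; _∪_; _⊆_; ⊥; ⊤; ⁅_⁆; ∣_∣)
open import Data.Fin.Subset.Properties
open import Data.Vec using (_∷_; []; tabulate; here; there)
open import Data.Vec.Properties using (lookup∘tabulate; tabulate-cong; []=⇒lookup; lookup⇒[]=)
open import Data.Bool using (Bool; true; false; not)
open import Data.Bool.Properties using (not-involutive)
open import Data.Product using (_×_; _,_)
open import Data.Sum using (inj₁; inj₂)
open import Function using (_∘_)
open import Relation.Binary.PropositionalEquality
  using (_≡_; refl; sym; trans; cong; cong₂; subst; module ≡-Reasoning)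

open +-*-Solver

∣p∪q∣≤∣p∣+∣q∣ : ∀ {n} (p q : Subset n) → ∣ p ∪ q ∣ ≤ ∣ p ∣ + ∣ q ∣
∣p∪q∣≤∣p∣+∣q∣ [] [] = z≤n
∣p∪q∣≤∣p∣+∣q∣ (true ∷ p) (true ∷ q) =
  s≤s (≤-trans (∣p∪q∣≤∣p∣+∣q∣ p q) (+-monoʳ-≤ ∣ p ∣ (n≤1+n _)))
∣p∪q∣≤∣p∣+∣q∣ (true ∷ p) (false ∷ q) = s≤s (∣p∪q∣≤∣p∣+∣q∣ p q)
∣p∪q∣≤∣p∣+∣q∣ (false ∷ p) (true ∷ q) =
  subst (suc ∣ p ∪ q ∣ ≤_) (sym (+-suc ∣ p ∣ ∣ q ∣)) (s≤s (∣p∪q∣≤∣p∣+∣q∣ p q))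
∣p∪q∣≤∣p∣+∣q∣ (false ∷ p) (false ∷ q) = ∣p∪q∣≤∣p∣+∣q∣ p q

⋃-over : ∀ {m n} → Subset m → (Fin m → Subset n) → Subset n
⋃-over [] f = ⊥
⋃-over (true ∷ s) f = f fzero ∪ ⋃-over s (f ∘ fsuc)
⋃-over (false ∷ s) f = ⋃-over s (f ∘ fsuc)

∣⋃-over∣≤∣s∣* : ∀ {m n} d (s : Subset m) (f : Fin m → Subset n) →
  (∀ i → ∣ f i ∣ ≤ d) → ∣ ⋃-over s f ∣ ≤ ∣ s ∣ * d
∣⋃-over∣≤∣s∣* {n = n} d [] f ∣f∣≤d = ≤-reflexive (∣⊥∣≡0 n)
∣⋃-over∣≤∣s∣* d (true ∷ s) f ∣f∣≤d =
  ≤-trans (∣p∪q∣≤∣p∣+∣q∣ (f fzero) (⋃-over s (f ∘ fsuc)))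
          (+-mono-≤ (∣f∣≤d fzero) (∣⋃-over∣≤∣s∣* d s (f ∘ fsuc) (∣f∣≤d ∘ fsuc)))
∣⋃-over∣≤∣s∣* d (false ∷ s) f ∣f∣≤d = ∣⋃-over∣≤∣s∣* d s (f ∘ fsuc) (∣f∣≤d ∘ fsuc)

x∈⋃-over : ∀ {m n} (s : Subset m) (f : Fin m → Subset n) {i x} →
  i ∈ s → x ∈ f i → x ∈ ⋃-over s f
x∈⋃-over (true ∷ s) f here x∈fi = x∈p∪q⁺ (inj₁ x∈fi)
x∈⋃-over (true ∷ s) f (there i∈s) x∈fi = x∈p∪q⁺ (inj₂ (x∈⋃-over s (f ∘ fsuc) i∈s x∈fi))
x∈⋃-over (false ∷ s) f (there i∈s) x∈fi = x∈⋃-over s (f ∘ fsuc) i∈s x∈fi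

x∈tabulate⁺ : ∀ {n} (f : Fin n → Bool) {x} → f x ≡ true → x ∈ tabulate f
x∈tabulate⁺ f {x} fx = lookup⇒[]= x (tabulate f) (trans (lookup∘tabulate f x) fx)

x∈tabulate⁻ : ∀ {n} (f : Fin n → Bool) {x} → x ∈ tabulate f → f x ≡ true
x∈tabulate⁻ f {x} x∈f = trans (sym (lookup∘tabulate f x)) ([]=⇒lookup x∈f)

∣p∩f∣+∣p∩¬f∣≡∣p∣ : ∀ {n} (p : Subset n) (f : Fin n → Bool) →
  ∣ p ∩ tabulate f ∣ + ∣ p ∩ tabulate (not ∘ f) ∣ ≡ ∣ p ∣
∣p∩f∣+∣p∩¬f∣≡∣p∣ [] f = refl
∣p∩f∣+∣p∩¬f∣≡∣p∣ (true ∷ p) f with f fzero | ∣p∩f∣+∣p∩¬f∣≡∣p∣ p (f ∘ fsuc)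
... | true  | ih = cong suc ih
... | false | ih = trans (+-suc _ _) (cong suc ih)
∣p∩f∣+∣p∩¬f∣≡∣p∣ (false ∷ p) f = ∣p∩f∣+∣p∩¬f∣≡∣p∣ p (f ∘ fsuc)

isEvenᵇ-suc : ∀ k → isEvenᵇ (suc k) ≡ not (isEvenᵇ k)
isEvenᵇ-suc zero = refl
isEvenᵇ-suc (suc k) = trans (sym (not-involutive _)) (cong not (sym (isEvenᵇ-suc k)))

isEvenᵇ-odd-sum : ∀ a b → (a + b) % 2 ≡ 1 → isEvenᵇ a ≡ not (isEvenᵇ b)
isEvenᵇ-odd-sum zero b a+b-odd rewrite a+b-odd = refl
isEvenᵇ-odd-sum (suc a) b a+b-odd = begin
    isEvenᵇ (suc a)
  ≡⟨ isEvenᵇ-suc a ⟩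
    not (isEvenᵇ a)
  ≡⟨ cong not (isEvenᵇ-odd-sum a (suc b) (trans (cong (_% 2) (+-suc a b)) a+b-odd)) ⟩
    not (not (isEvenᵇ (suc b)))
  ≡⟨ not-involutive _ ⟩
    isEvenᵇ (suc b)
  ≡⟨ isEvenᵇ-suc b ⟩
    not (isEvenᵇ b) ∎
  where open ≡-Reasoning

[2^t∸1]%2≡1 : ∀ t → 1 ≤ t → (2 ^ t ∸ 1) % 2 ≡ 1
[2^t∸1]%2≡1 (suc t) _ with 2 ^ t | m^n>0 2 t
... | suc q | _ = trans (cong (_% 2) 2[1+q]∸1≡1+q*2) ([m+kn]%n≡m%n 1 q 2)
  where
  2[1+q]∸1≡1+q*2 : q + suc (q + 0) ≡ 1 + q * 2
  2[1+q]∸1≡1+q*2 = trans (+-suc q (q + 0)) (cong suc (sym (*-comm q 2)))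

∣evens[1+n]∣≡1+∣odds[n]∣ : ∀ n → ∣ evens (suc n) ∣ ≡ suc ∣ odds n ∣
∣evens[1+n]∣≡1+∣odds[n]∣ n =
  cong (λ (p : Subset n) → ∣ true ∷ p ∣) (tabulate-cong (λ i → isEvenᵇ-suc (toℕ i)))

∣odds[1+n]∣≡∣evens[n]∣ : ∀ n → ∣ odds (suc n) ∣ ≡ ∣ evens n ∣
∣odds[1+n]∣≡∣evens[n]∣ n = cong (∣_∣ {n = n})
  (tabulate-cong (λ i → trans (cong not (isEvenᵇ-suc (toℕ i))) (not-involutive _)))

∣evens∣≡∣odds∣ : ∀ {n} → 2 ∣ n → ∣ evens n ∣ ≡ ∣ odds n ∣
∣evens∣≡∣odds∣ (divides zero refl) = refl
∣evens∣≡∣odds∣ (divides (suc q) refl) = begin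
    ∣ evens (suc (suc (q * 2))) ∣
  ≡⟨ ∣evens[1+n]∣≡1+∣odds[n]∣ (suc (q * 2)) ⟩
    suc ∣ odds (suc (q * 2)) ∣
  ≡⟨ cong suc (∣odds[1+n]∣≡∣evens[n]∣ (q * 2)) ⟩
    suc ∣ evens (q * 2) ∣
  ≡⟨ cong suc (∣evens∣≡∣odds∣ (divides q refl)) ⟩
    suc ∣ odds (q * 2) ∣
  ≡⟨ sym (∣evens[1+n]∣≡1+∣odds[n]∣ (q * 2)) ⟩
    ∣ evens (suc (q * 2)) ∣
  ≡⟨ sym (∣odds[1+n]∣≡∣evens[n]∣ (suc (q * 2))) ⟩
    ∣ odds (suc (suc (q * 2))) ∣ ∎
  where open ≡-Reasoning

∣p∩evens∣+∣p∩odds∣≡∣p∣ : ∀ {n} (p : Subset n) → ∣ p ∩ evens n ∣ + ∣ p ∩ odds n ∣ ≡ ∣ p ∣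
∣p∩evens∣+∣p∩odds∣≡∣p∣ p = ∣p∩f∣+∣p∩¬f∣≡∣p∣ p (λ i → isEvenᵇ (toℕ i))

∣evens∣+∣odds∣≡n : ∀ n → ∣ evens n ∣ + ∣ odds n ∣ ≡ n
∣evens∣+∣odds∣≡n n = begin
    ∣ evens n ∣ + ∣ odds n ∣
  ≡⟨ sym (cong₂ _+_ (cong ∣_∣ (∩-identityˡ (evens n))) (cong ∣_∣ (∩-identityˡ (odds n)))) ⟩
    ∣ ⊤ {n} ∩ evens n ∣ + ∣ ⊤ {n} ∩ odds n ∣
  ≡⟨ ∣p∩evens∣+∣p∩odds∣≡∣p∣ (⊤ {n}) ⟩
    ∣ ⊤ {n} ∣
  ≡⟨ ∣⊤∣≡n n ⟩
    n ∎
  where open ≡-Reasoning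

balanced⇒2∣∣p∣ : ∀ {n} (p : Subset n) → ∣ p ∩ evens n ∣ ≡ ∣ p ∩ odds n ∣ → 2 ∣ ∣ p ∣
balanced⇒2∣∣p∣ {n} p balanced = divides ∣ p ∩ evens n ∣ (begin
    ∣ p ∣
  ≡⟨ sym (∣p∩evens∣+∣p∩odds∣≡∣p∣ p) ⟩
    ∣ p ∩ evens n ∣ + ∣ p ∩ odds n ∣
  ≡⟨ cong (∣ p ∩ evens n ∣ +_) (sym balanced) ⟩
    ∣ p ∩ evens n ∣ + ∣ p ∩ evens n ∣
  ≡⟨ solve 1 (λ e → e :+ e := e :* con 2) refl ∣ p ∩ evens n ∣ ⟩
    ∣ p ∩ evens n ∣ * 2 ∎)
  where open ≡-Reasoning

≤-sum-tight : ∀ {a b c} → c ≤ a → c ≤ b → a + b ≡ c + c → a ≡ c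
≤-sum-tight {a} {b} {c} c≤a c≤b a+b≡c+c =
  ≤-antisym (+-cancelʳ-≤ b a c (≤-trans (≤-reflexive a+b≡c+c) (+-monoʳ-≤ c c≤b))) c≤a

cross-cancel : ∀ {e o d} → 2 ≤ d → e + o * d ≡ o + e * d → e ≡ o
cross-cancel {e} {o} {suc (suc d)} (s≤s (s≤s _)) cross =
  sym (*-cancelˡ-≡ o e (suc d) (+-cancelˡ-≡ (e + o) _ _ (begin
      (e + o) + suc d * o
    ≡⟨ solve 3 (λ e o d → (e :+ o) :+ (con 1 :+ d) :* o := e :+ o :* (con 2 :+ d)) refl e o d ⟩
      e + o * suc (suc d)
    ≡⟨ cross ⟩
      o + e * suc (suc d)
    ≡⟨ solve 3 (λ e o d → o :+ e :* (con 2 :+ d) := (e :+ o) :+ (con 1 :+ d) :* e) refl e o d ⟩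
      (e + o) + suc d * e ∎)))
  where open ≡-Reasoning

tight-bounds⇒≡ : ∀ {c e o d} → 2 ≤ d → c ≤ e + o * d → c ≤ o + e * d →
  (e + o) * suc d ≡ c + c → e ≡ o
tight-bounds⇒≡ {c} {e} {o} {d} 2≤d c≤e+od c≤o+ed [e+o][1+d]≡2c =
  cross-cancel 2≤d (trans (≤-sum-tight c≤e+od c≤o+ed sum≡2c)
                          (sym (≤-sum-tight c≤o+ed c≤e+od (trans (+-comm (o + e * d) _) sum≡2c))))
  where
  sum≡2c : (e + o * d) + (o + e * d) ≡ c + c
  sum≡2c = trans (solve 3 (λ e o d → (e :+ o :* d) :+ (o :+ e :* d) := (e :+ o) :* (con 1 :+ d))
                         refl e o d)
                 [e+o][1+d]≡2c

module KnödelGraph (m : ℕ) where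

  private
    N : ℕ
    N = suc m

  complementMod : ℕ → Fin N → Fin N
  complementMod c u = fromℕ< (m%n<n (c + (N ∸ toℕ u)) N)

  +≡c⇒≡complementMod : ∀ c u v → (toℕ u + toℕ v) % N ≡ c % N → v ≡ complementMod c u
  +≡c⇒≡complementMod c u v u+v≡c = toℕ-injective (begin
      toℕ v
    ≡⟨ sym (m<n⇒m%n≡m (toℕ<n v)) ⟩
      toℕ v % N
    ≡⟨ sym ([m+n]%n≡m%n (toℕ v) N) ⟩
      (toℕ v + N) % N
    ≡⟨ %-congˡ (sym [u+v]+[N∸u]≡v+N) ⟩
      (toℕ u + toℕ v + (N ∸ toℕ u)) % N
    ≡⟨ %-distribˡ-+ (toℕ u + toℕ v) (N ∸ toℕ u) N ⟩
      ((toℕ u + toℕ v) % N + (N ∸ toℕ u) % N) % N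
    ≡⟨ %-congˡ (cong (_+ (N ∸ toℕ u) % N) u+v≡c) ⟩
      (c % N + (N ∸ toℕ u) % N) % N
    ≡⟨ sym (%-distribˡ-+ c (N ∸ toℕ u) N) ⟩
      (c + (N ∸ toℕ u)) % N
    ≡⟨ sym (toℕ-fromℕ< _) ⟩
      toℕ (complementMod c u) ∎)
    where
    open ≡-Reasoning
    [u+v]+[N∸u]≡v+N : toℕ u + toℕ v + (N ∸ toℕ u) ≡ toℕ v + N
    [u+v]+[N∸u]≡v+N = begin
        toℕ u + toℕ v + (N ∸ toℕ u)
      ≡⟨ cong (_+ (N ∸ toℕ u)) (+-comm (toℕ u) (toℕ v)) ⟩
        toℕ v + toℕ u + (N ∸ toℕ u)
      ≡⟨ +-assoc (toℕ v) (toℕ u) _ ⟩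
        toℕ v + (toℕ u + (N ∸ toℕ u))
      ≡⟨ cong (toℕ v +_) (m+[n∸m]≡n (<⇒≤ (toℕ<n u))) ⟩
        toℕ v + N ∎

  neighbourhood : Fin N → ℕ → Subset N
  neighbourhood u zero = ⊥
  neighbourhood u (suc t) = ⁅ complementMod (2 ^ suc t ∸ 1) u ⁆ ∪ neighbourhood u t

  ∣neighbourhood∣≤ : ∀ u d → ∣ neighbourhood u d ∣ ≤ d
  ∣neighbourhood∣≤ u zero = ≤-reflexive (∣⊥∣≡0 N)
  ∣neighbourhood∣≤ u (suc d) =
    ≤-trans (∣p∪q∣≤∣p∣+∣q∣ ⁅ complementMod (2 ^ suc d ∸ 1) u ⁆ (neighbourhood u d))
            (+-mono-≤ (≤-reflexive (∣⁅x⁆∣≡1 (complementMod (2 ^ suc d ∸ 1) u)))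
                      (∣neighbourhood∣≤ u d))

  complementMod∈neighbourhood : ∀ u {t} d → 1 ≤ t → t ≤ d →
    complementMod (2 ^ t ∸ 1) u ∈ neighbourhood u d
  complementMod∈neighbourhood u zero (s≤s _) ()
  complementMod∈neighbourhood u (suc d) 1≤t t≤1+d with m≤n⇒m<n∨m≡n t≤1+d
  ... | inj₂ refl = x∈p∪q⁺ (inj₁ (x∈⁅x⁆ _))
  ... | inj₁ (s≤s t≤d) = x∈p∪q⁺ (inj₂ (complementMod∈neighbourhood u d 1≤t t≤d))

  KGAdj⇒∈neighbourhood : ∀ u v → KGAdj N u v → v ∈ neighbourhood u ⌊log₂ N ⌋
  KGAdj⇒∈neighbourhood u v (t , 1≤t , t≤d , u+v≡2^t∸1) =
    subst (_∈ neighbourhood u ⌊log₂ N ⌋) (sym (+≡c⇒≡complementMod (2 ^ t ∸ 1) u v u+v≡2^t∸1))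
          (complementMod∈neighbourhood u ⌊log₂ N ⌋ 1≤t t≤d)

  ∣A∣≤∣D∩A∣+∣D∩B∣*⌊log₂n⌋ : ∀ {D A B} → IsDominating N D →
    (∀ u v → KGAdj N u v → v ∈ A → u ∈ B) →
    ∣ A ∣ ≤ ∣ D ∩ A ∣ + ∣ D ∩ B ∣ * ⌊log₂ N ⌋
  ∣A∣≤∣D∩A∣+∣D∩B∣*⌊log₂n⌋ {D} {A} {B} dom nbrs[A]⊆B =
    ≤-trans (p⊆q⇒∣p∣≤∣q∣ A⊆cover)
            (≤-trans (∣p∪q∣≤∣p∣+∣q∣ (D ∩ A) _)
                     (+-monoʳ-≤ ∣ D ∩ A ∣ (∣⋃-over∣≤∣s∣* ⌊log₂ N ⌋ (D ∩ B) nbhd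
                                             (λ u → ∣neighbourhood∣≤ u ⌊log₂ N ⌋))))
    where
    nbhd : Fin N → Subset N
    nbhd u = neighbourhood u ⌊log₂ N ⌋
    A⊆cover : A ⊆ (D ∩ A) ∪ ⋃-over (D ∩ B) nbhd
    A⊆cover {v} v∈A with dom v
    ... | inj₁ v∈D = x∈p∪q⁺ (inj₁ (x∈p∩q⁺ (v∈D , v∈A)))
    ... | inj₂ (u , u∈D , uv) = x∈p∪q⁺ (inj₂ (x∈⋃-over (D ∩ B) nbhd
            (x∈p∩q⁺ (u∈D , nbrs[A]⊆B u v uv v∈A)) (KGAdj⇒∈neighbourhood u v uv)))

  KGAdj⇒oppositeParity : 2 ∣ N → ∀ u v → KGAdj N u v →
    isEvenᵇ (toℕ u) ≡ not (isEvenᵇ (toℕ v))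
  KGAdj⇒oppositeParity 2∣N u v (t , 1≤t , _ , u+v≡2^t∸1) =
    isEvenᵇ-odd-sum (toℕ u) (toℕ v) (begin
        (toℕ u + toℕ v) % 2
      ≡⟨ sym (m∣n⇒o%n%m≡o%m 2 N (toℕ u + toℕ v) 2∣N) ⟩
        (toℕ u + toℕ v) % N % 2
      ≡⟨ cong (_% 2) u+v≡2^t∸1 ⟩
        (2 ^ t ∸ 1) % N % 2
      ≡⟨ m∣n⇒o%n%m≡o%m 2 N (2 ^ t ∸ 1) 2∣N ⟩
        (2 ^ t ∸ 1) % 2
      ≡⟨ [2^t∸1]%2≡1 t 1≤t ⟩
        1 ∎)
    where open ≡-Reasoning

  ∈evens⇒nbr∈odds : 2 ∣ N → ∀ u v → KGAdj N u v → v ∈ evens N → u ∈ odds N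
  ∈evens⇒nbr∈odds 2∣N u v uv v∈evens = x∈tabulate⁺ (λ i → not (isEvenᵇ (toℕ i)))
    (cong not (trans (KGAdj⇒oppositeParity 2∣N u v uv)
                     (cong not (x∈tabulate⁻ (λ i → isEvenᵇ (toℕ i)) v∈evens))))

  ∈odds⇒nbr∈evens : 2 ∣ N → ∀ u v → KGAdj N u v → v ∈ odds N → u ∈ evens N
  ∈odds⇒nbr∈evens 2∣N u v uv v∈odds = x∈tabulate⁺ (λ i → isEvenᵇ (toℕ i))
    (trans (KGAdj⇒oppositeParity 2∣N u v uv) (x∈tabulate⁻ (λ i → not (isEvenᵇ (toℕ i))) v∈odds))

  dominating-of-size-n/[d+1]⇒balanced : 2 ≤ ⌊log₂ N ⌋ → 2 ∣ N → ∀ {D} → IsDominating N D →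
    ∣ D ∣ * suc ⌊log₂ N ⌋ ≡ N → ∣ D ∩ evens N ∣ ≡ ∣ D ∩ odds N ∣
  dominating-of-size-n/[d+1]⇒balanced 2≤d 2∣N {D} dom ∣D∣[1+d]≡N =
    tight-bounds⇒≡ 2≤d
      (∣A∣≤∣D∩A∣+∣D∩B∣*⌊log₂n⌋ dom (∈evens⇒nbr∈odds 2∣N))
      (subst (_≤ ∣ D ∩ odds N ∣ + ∣ D ∩ evens N ∣ * ⌊log₂ N ⌋) (sym (∣evens∣≡∣odds∣ 2∣N))
             (∣A∣≤∣D∩A∣+∣D∩B∣*⌊log₂n⌋ dom (∈odds⇒nbr∈evens 2∣N)))
      (begin
        (∣ D ∩ evens N ∣ + ∣ D ∩ odds N ∣) * suc ⌊log₂ N ⌋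
      ≡⟨ cong (_* suc ⌊log₂ N ⌋) (∣p∩evens∣+∣p∩odds∣≡∣p∣ D) ⟩
        ∣ D ∣ * suc ⌊log₂ N ⌋
      ≡⟨ ∣D∣[1+d]≡N ⟩
        N
      ≡⟨ sym (∣evens∣+∣odds∣≡n N) ⟩
        ∣ evens N ∣ + ∣ odds N ∣
      ≡⟨ cong (∣ evens N ∣ +_) (sym (∣evens∣≡∣odds∣ 2∣N)) ⟩
        ∣ evens N ∣ + ∣ evens N ∣ ∎)
    where open ≡-Reasoning

corollary12 : (n : ℕ) → 6 ≤ n → 2 ∣ n → suc ⌊log₂ n ⌋ ∣ n →
    GammaKG≡ n (n / suc ⌊log₂ n ⌋) →
    (2 ∣ n / suc ⌊log₂ n ⌋) ×
    (∀ (D : Subset n) → IsMinDominating n D →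
      ∣ D ∩ evens n ∣ ≡ ∣ D ∩ odds n ∣)
corollary12 zero () _ _ _
corollary12 n@(suc m) 6≤n 2∣n [1+d]∣n ((D₀ , D₀-dom , ∣D₀∣≡k) , γ-minimal) =
  subst (2 ∣_) ∣D₀∣≡k (balanced⇒2∣∣p∣ D₀ (size-k⇒balanced D₀-dom ∣D₀∣≡k)) ,
  λ D (D-dom , D-minimum) → size-k⇒balanced D-dom
    (≤-antisym (subst (∣ D ∣ ≤_) ∣D₀∣≡k (D-minimum D₀ D₀-dom)) (γ-minimal D D-dom))
  where
  open KnödelGraph m
  2≤d : 2 ≤ ⌊log₂ n ⌋
  2≤d = subst (_≤ ⌊log₂ n ⌋) (⌊log₂[2^n]⌋≡n 2) (⌊log₂⌋-mono-≤ (≤-trans (m≤n+m 4 2) 6≤n))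
  size-k⇒balanced : ∀ {D} → IsDominating n D → ∣ D ∣ ≡ n / suc ⌊log₂ n ⌋ →
    ∣ D ∩ evens n ∣ ≡ ∣ D ∩ odds n ∣
  size-k⇒balanced dom ∣D∣≡k = dominating-of-size-n/[d+1]⇒balanced 2≤d 2∣n dom
    (trans (cong (_* suc ⌊log₂ n ⌋) ∣D∣≡k)
           (trans (*-comm _ (suc ⌊log₂ n ⌋)) (m*[n/m]≡n [1+d]∣n)))
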